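{- Let $K_{a,b}$ be the complete bipartite graph with parts of sizes $a$ and $b$, and let $k$ be a positive integer with $\left\lceil\frac{k}{2}\right\rceil+1\le a\le b$. Then $$b_t^k(K_{a,b})\le \left\lceil\frac{k}{2}\right\rceil\left(a+b-\left\lceil\frac{k}{2}\right\rceil-1\right).$$
   Context: $\gamma_t(K_{a,b})=2$ for $2\le a\le b$. A total dominating set of a graph without isolated vertices is a vertex set $S$ such that every vertex is adjacent to some vertex of $S$; $\gamma_t(G)$ is the minimum size of such a set. The $k$-total bondage number $b_t^k(G)$ is the minimum number of edges that must be deleted from $G$ so that the resulting graph (required to have no isolated vertices) has total domination number at least $\gamma_t(G)+k$. -}

module Defs where

open import Data.Nat using (ℕ; zero; suc; _+_; _≤_; _<ᵇ_)
open import Data.Bool using (Bool; true; false; _∧_; _xor_; not; if_then_else_)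
open import Data.Fin using (Fin; toℕ)
open import Data.Fin.Subset using (Subset; _∈_; ∣_∣)
open import Data.List using (List; map; allFin)
open import Data.Nat.ListAction using (sum)
open import Data.Product using (Σ; _×_; ∃)
open import Relation.Binary.PropositionalEquality using (_≡_)

record Graph (n : ℕ) : Set where
  field
    adj   : Fin n → Fin n → Bool
    sym   : ∀ u v → adj u v ≡ adj v u
    irrefl : ∀ v → adj v v ≡ false
open Graph public

-- Complete bipartite graph K_{a,b}: vertices 0..a-1 form one part,
-- a..a+b-1 the other; u ~ v iff they lie in different parts.
side : (a : ℕ) {n : ℕ} → Fin n → Bool
side a v = toℕ v <ᵇ a

K : (a b : ℕ) → Graph (a + b)
K a b = record
  { adj = λ u v → side a u xor side a v
  ; sym = λ u v → xor-sym (side a u) (side a v)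
  ; irrefl = λ v → xor-self (side a v)
  }
  where
  xor-sym : ∀ x y → (x xor y) ≡ (y xor x)
  xor-sym true true = Relation.Binary.PropositionalEquality.refl
  xor-sym true false = Relation.Binary.PropositionalEquality.refl
  xor-sym false true = Relation.Binary.PropositionalEquality.refl
  xor-sym false false = Relation.Binary.PropositionalEquality.refl
  xor-self : ∀ x → (x xor x) ≡ false
  xor-self true = Relation.Binary.PropositionalEquality.refl
  xor-self false = Relation.Binary.PropositionalEquality.refl

NoIsolated : {n : ℕ} → Graph n → Set
NoIsolated {n} G = ∀ (v : Fin n) → ∃ λ (u : Fin n) → adj G u v ≡ true

IsTDS : {n : ℕ} → Graph n → Subset n → Set
IsTDS {n} G S = ∀ (v : Fin n) → ∃ λ (u : Fin n) → (u ∈ S) × (adj G u v ≡ true)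

IsTotalDomNumber : {n : ℕ} → Graph n → ℕ → Set
IsTotalDomNumber {n} G t =
  (∃ λ (S : Subset n) → IsTDS G S × ∣ S ∣ ≡ t) × (∀ (S : Subset n) → IsTDS G S → t ≤ ∣ S ∣)

TotalDomAtLeast : {n : ℕ} → Graph n → ℕ → Set
TotalDomAtLeast {n} G c = ∀ (S : Subset n) → IsTDS G S → c ≤ ∣ S ∣

-- H is a spanning subgraph of G (i.e. H = G − F for the edge set F of
-- edges of G not in H).
SpanningSubgraph : {n : ℕ} → Graph n → Graph n → Set
SpanningSubgraph {n} H G = ∀ (u v : Fin n) → adj H u v ≡ true → adj G u v ≡ true

deletedEdges : {n : ℕ} → Graph n → Graph n → ℕ
deletedEdges {n} G H =
  sum (map (λ u → sum (map (λ v →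
        if (toℕ u <ᵇ toℕ v) ∧ adj G u v ∧ not (adj H u v) then 1 else 0)
      (allFin n))) (allFin n))

-- Put m = ⌈k/2⌉ and give the i-th vertex of either part the colour min(i, m).
-- Deleting the edges of K_{a,b} between different colours leaves m disjoint
-- edges {i, a+i} (i < m) together with a copy of K_{a−m,b−m}. This graph has
-- no isolated vertex, and a total dominating set must contain both ends of
-- each of the m edges plus one vertex from each side of the K_{a−m,b−m}; so
-- γ_t ≥ 2m + 2 ≥ γ_t(K_{a,b}) + k, as γ_t(K_{a,b}) ≤ 2. The deleted edges are
-- b − 1 at each of the vertices i < m of the first part and m at each of the
-- other a − m, which makes m(b − 1) + (a − m)m = m(a + b − m − 1).
module Submission where

open import Defs hiding (sym)
open import Data.Nat using (ℕ; _+_; _∸_; _*_; _≤_; ⌈_/2⌉)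
open import Data.Product using (∃; _×_)

open import Data.Nat using (zero; suc; _<_; _<ᵇ_; _≡ᵇ_; _⊓_; z≤n; s≤s; s≤s⁻¹; z<s; _<?_; _≟_)
open import Data.Nat.Properties
open import Data.Bool using (Bool; true; false; _∧_; _xor_; not; if_then_else_)
open import Data.Bool.Properties
  using (T-≡; ¬-not; ∧-conicalˡ; ∧-conicalʳ; ∧-zeroʳ; ∧-identityʳ; ∧-inverseʳ; xor-same)
open import Data.Product using (_,_)
open import Data.Sum using (inj₁; inj₂)
open import Data.Fin using (Fin; toℕ; fromℕ<) renaming (zero to fzero; suc to fsuc)
open import Data.Fin.Properties using (toℕ-fromℕ<)
open import Data.Fin.Subset using (Subset; _∈_; ∣_∣; ⁅_⁆; _∪_; _-_)
open import Data.Fin.Subset.Properties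
  using (x∈⁅x⁆; p⊆p∪q; q⊆p∪q; ∣⁅x⁆∣≡1; x∈p∧x≢y⇒x∈p-y; x∈p⇒∣p-x∣<∣p∣)
open import Data.Vec using (_∷_; [])
open import Data.List using (List; _∷_; map; allFin; tabulate; _++_; length; upTo; applyUpTo)
open import Data.List.Properties using (map-tabulate; length-++; length-upTo; length-applyUpTo)
open import Data.List.Relation.Unary.All using (All; []; _∷_)
import Data.List.Relation.Unary.All as All
import Data.List.Relation.Unary.All.Properties as All
import Data.List.Relation.Unary.AllPairs.Properties as AllPairs
open import Data.List.Relation.Unary.Unique.Propositional using (Unique; []; _∷_)
open import Data.List.Relation.Unary.Unique.Propositional.Properties using (upTo⁺)
open import Data.Nat.ListAction using (sum)
open import Function using (_∘_; Equivalence)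
open import Relation.Nullary using (contradiction; yes; no)
open import Relation.Binary.PropositionalEquality
  using (_≡_; _≢_; refl; sym; trans; cong; cong₂; subst; module ≡-Reasoning)

<ᵇ-true : ∀ {m n} → m < n → (m <ᵇ n) ≡ true
<ᵇ-true m<n = Equivalence.to T-≡ (<⇒<ᵇ m<n)

<ᵇ-false : ∀ {m n} → n ≤ m → (m <ᵇ n) ≡ false
<ᵇ-false n≤m = ¬-not (λ m<ᵇn → ≤⇒≯ n≤m (<ᵇ⇒< _ _ (Equivalence.from T-≡ m<ᵇn)))

≡⇒≡ᵇ≡true : ∀ {m n} → m ≡ n → (m ≡ᵇ n) ≡ true
≡⇒≡ᵇ≡true {m} {n} m≡n = Equivalence.to T-≡ (≡⇒≡ᵇ m n m≡n)

≡ᵇ≡true⇒≡ : ∀ {m n} → (m ≡ᵇ n) ≡ true → m ≡ n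
≡ᵇ≡true⇒≡ {m} {n} e = ≡ᵇ⇒≡ m n (Equivalence.from T-≡ e)

≡ᵇ-comm : ∀ m n → (m ≡ᵇ n) ≡ (n ≡ᵇ m)
≡ᵇ-comm zero    zero    = refl
≡ᵇ-comm zero    (suc n) = refl
≡ᵇ-comm (suc m) zero    = refl
≡ᵇ-comm (suc m) (suc n) = ≡ᵇ-comm m n

m⊓o≡n<o⇒m≡n : ∀ {m n o} → m ⊓ o ≡ n → n < o → m ≡ n
m⊓o≡n<o⇒m≡n {m} {n} {o} m⊓o≡n n<o with ⊓-sel m o
... | inj₁ m⊓o≡m = trans (sym m⊓o≡m) m⊓o≡n
... | inj₂ m⊓o≡o = contradiction (subst (_< o) (trans (sym m⊓o≡n) m⊓o≡o) n<o) (<-irrefl refl)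

k≤⌈k/2⌉+⌈k/2⌉ : ∀ k → k ≤ ⌈ k /2⌉ + ⌈ k /2⌉
k≤⌈k/2⌉+⌈k/2⌉ k = subst (_≤ ⌈ k /2⌉ + ⌈ k /2⌉) (⌊n/2⌋+⌈n/2⌉≡n k) (+-monoˡ-≤ ⌈ k /2⌉ (⌊n/2⌋≤⌈n/2⌉ k))

∣p∪q∣≤∣p∣+∣q∣ : ∀ {n} (p q : Subset n) → ∣ p ∪ q ∣ ≤ ∣ p ∣ + ∣ q ∣
∣p∪q∣≤∣p∣+∣q∣ []          []          = z≤n
∣p∪q∣≤∣p∣+∣q∣ (true ∷ p)  (true ∷ q)  =
  s≤s (≤-trans (∣p∪q∣≤∣p∣+∣q∣ p q) (≤-trans (n≤1+n _) (≤-reflexive (sym (+-suc ∣ p ∣ ∣ q ∣)))))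
∣p∪q∣≤∣p∣+∣q∣ (true ∷ p)  (false ∷ q) = s≤s (∣p∪q∣≤∣p∣+∣q∣ p q)
∣p∪q∣≤∣p∣+∣q∣ (false ∷ p) (true ∷ q)  = ≤-trans (s≤s (∣p∪q∣≤∣p∣+∣q∣ p q)) (≤-reflexive (sym (+-suc ∣ p ∣ ∣ q ∣)))
∣p∪q∣≤∣p∣+∣q∣ (false ∷ p) (false ∷ q) = ∣p∪q∣≤∣p∣+∣q∣ p q

_∈ℕ_ : ∀ {n} → ℕ → Subset n → Set
j ∈ℕ S = ∃ λ v → v ∈ S × toℕ v ≡ j

length≤∣S∣ : ∀ {n} (S : Subset n) {js : List ℕ} → Unique js → All (_∈ℕ S) js → length js ≤ ∣ S ∣
length≤∣S∣ S []           []                        = z≤n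
length≤∣S∣ S (v∉js ∷ js!) ((v , v∈S , refl) ∷ js∈S) =
  ≤-trans (s≤s (length≤∣S∣ (S - v) js! (All.zipWith ∈S-v (v∉js , js∈S)))) (x∈p⇒∣p-x∣<∣p∣ v∈S)
  where
  ∈S-v : ∀ {j} → toℕ v ≢ j × j ∈ℕ S → j ∈ℕ (S - v)
  ∈S-v (v≢w , w , w∈S , refl) = w , x∈p∧x≢y⇒x∈p-y w∈S (v≢w ∘ cong toℕ ∘ sym) , refl

sumFrom : (ℕ → ℕ) → ℕ → ℕ → ℕ
sumFrom f s zero    = 0
sumFrom f s (suc l) = f s + sumFrom f (suc s) l

sum-tabulate≤sumFrom : ∀ {n} {h : Fin n → ℕ} {f : ℕ → ℕ} s → (∀ v → h v ≤ f (s + toℕ v)) →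
                       sum (tabulate h) ≤ sumFrom f s n
sum-tabulate≤sumFrom {zero}  s h≤f = z≤n
sum-tabulate≤sumFrom {suc n} {h} {f} s h≤f =
  +-mono-≤ (subst (λ j → h fzero ≤ f j) (+-identityʳ s) (h≤f fzero))
           (sum-tabulate≤sumFrom (suc s) λ v → subst (λ j → h (fsuc v) ≤ f j) (+-suc s (toℕ v)) (h≤f (fsuc v)))

sum-allFin≤sumFrom : ∀ {n} {h : Fin n → ℕ} {f : ℕ → ℕ} → (∀ v → h v ≤ f (toℕ v)) →
                     sum (map h (allFin n)) ≤ sumFrom f 0 n
sum-allFin≤sumFrom {n} {h} h≤f rewrite map-tabulate {n = n} (λ v → v) h = sum-tabulate≤sumFrom 0 h≤f

sumFrom-+ : ∀ f s l₁ l₂ → sumFrom f s (l₁ + l₂) ≡ sumFrom f s l₁ + sumFrom f (s + l₁) l₂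
sumFrom-+ f s zero     l₂ rewrite +-identityʳ s = refl
sumFrom-+ f s (suc l₁) l₂ rewrite sumFrom-+ f (suc s) l₁ l₂ | +-suc s l₁ =
  sym (+-assoc (f s) (sumFrom f (suc s) l₁) _)

sumFrom-≤-* : ∀ f s l c → (∀ j → s ≤ j → j < s + l → f j ≤ c) → sumFrom f s l ≤ l * c
sumFrom-≤-* f s zero    c f≤c = z≤n
sumFrom-≤-* f s (suc l) c f≤c =
  +-mono-≤ (f≤c s ≤-refl (m<m+n s z<s))
           (sumFrom-≤-* f (suc s) l c λ j s<j j<s+1+l → f≤c j (<⇒≤ s<j) (subst (j <_) (sym (+-suc s l)) j<s+1+l))

sumFrom-≤-support : ∀ {f} → (∀ j → f j ≤ 1) → ∀ s l k → (∀ j → s + k ≤ j → f j ≡ 0) → sumFrom f s l ≤ k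
sumFrom-≤-support f≤1 s zero    k       f≡0 = z≤n
sumFrom-≤-support f≤1 s (suc l) zero    f≡0 rewrite f≡0 s (≤-reflexive (+-identityʳ s)) =
  sumFrom-≤-support f≤1 (suc s) l zero λ j 1+s≤j → f≡0 j (≤-trans (+-monoˡ-≤ 0 (n≤1+n s)) 1+s≤j)
sumFrom-≤-support f≤1 s (suc l) (suc k) f≡0 =
  +-mono-≤ (f≤1 s) (sumFrom-≤-support f≤1 (suc s) l k λ j 1+s+k≤j →
    f≡0 j (subst (_≤ j) (sym (+-suc s k)) 1+s+k≤j))

sumFrom-≤-pred : ∀ {f} → (∀ j → f j ≤ 1) → ∀ {z} s l → f z ≡ 0 → s ≤ z → z < s + l → sumFrom f s l ≤ l ∸ 1
sumFrom-≤-pred f≤1 s zero fz≡0 s≤z z<s+0 = contradiction (subst (_ <_) (+-identityʳ s) z<s+0) (≤⇒≯ s≤z)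
sumFrom-≤-pred {f} f≤1 {z} s (suc l) fz≡0 s≤z z<s+1+l with s ≟ z
... | yes refl rewrite fz≡0 =
  subst (sumFrom f (suc s) l ≤_) (*-identityʳ l) (sumFrom-≤-* f (suc s) l 1 λ j _ _ → f≤1 j)
... | no s≢z with l
...   | zero   = contradiction (≤-antisym s≤z (s≤s⁻¹ (subst (z <_) (+-comm s 1) z<s+1+l))) s≢z
...   | suc l′ = +-mono-≤ (f≤1 s)
  (sumFrom-≤-pred f≤1 (suc s) (suc l′) fz≡0 (≤∧≢⇒< s≤z s≢z) (subst (z <_) (+-suc s (suc l′)) z<s+1+l))

sameColourSubgraph : ∀ {n} → Graph n → (Fin n → ℕ) → Graph n
sameColourSubgraph G c = record
  { adj    = λ u v → adj G u v ∧ (c u ≡ᵇ c v)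
  ; sym    = λ u v → cong₂ _∧_ (Graph.sym G u v) (≡ᵇ-comm (c u) (c v))
  ; irrefl = λ v → cong (_∧ (c v ≡ᵇ c v)) (irrefl G v)
  }

module SameColour {n} {G : Graph n} {c : Fin n → ℕ} where

  sameColourSubgraph-spanning : SpanningSubgraph (sameColourSubgraph G c) G
  sameColourSubgraph-spanning u v = ∧-conicalˡ _ _

  sameColourSubgraph-adj⁺ : ∀ {u v} → adj G u v ≡ true → c u ≡ c v → adj (sameColourSubgraph G c) u v ≡ true
  sameColourSubgraph-adj⁺ Guv cu≡cv = cong₂ _∧_ Guv (≡⇒≡ᵇ≡true cu≡cv)

  sameColourSubgraph-adj⁻ : ∀ {u v} → adj (sameColourSubgraph G c) u v ≡ true → adj G u v ≡ true × c u ≡ c v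
  sameColourSubgraph-adj⁻ e = ∧-conicalˡ _ _ e , ≡ᵇ≡true⇒≡ (∧-conicalʳ _ _ e)

K-sameSide-nonadj : ∀ {a b} {u v : Fin (a + b)} → side a u ≡ side a v → adj (K a b) u v ≡ false
K-sameSide-nonadj {a} {v = v} su≡sv rewrite su≡sv = xor-same (side a v)

K-adj⇒< : ∀ {a b} {u v : Fin (a + b)} → adj (K a b) u v ≡ true → a ≤ toℕ v → toℕ u < a
K-adj⇒< {a} {b} {u} {v} Kuv a≤v = ≰⇒> λ a≤u →
  contradiction (trans (sym Kuv) (K-sameSide-nonadj {a} {b} {u} {v} (trans (<ᵇ-false a≤u) (sym (<ᵇ-false a≤v))))) λ ()

K-adj⇒≥ : ∀ {a b} {u v : Fin (a + b)} → adj (K a b) u v ≡ true → toℕ v < a → a ≤ toℕ u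
K-adj⇒≥ {a} {b} {u} {v} Kuv v<a = ≮⇒≥ λ u<a →
  contradiction (trans (sym Kuv) (K-sameSide-nonadj {a} {b} {u} {v} (trans (<ᵇ-true u<a) (sym (<ᵇ-true v<a))))) λ ()

K-adj⁺ : ∀ {a b} {u v : Fin (a + b)} → toℕ u < a → a ≤ toℕ v → adj (K a b) u v ≡ true
K-adj⁺ u<a a≤v = cong₂ _xor_ (<ᵇ-true u<a) (<ᵇ-false a≤v)

K-adj⁺′ : ∀ {a b} {u v : Fin (a + b)} → a ≤ toℕ u → toℕ v < a → adj (K a b) u v ≡ true
K-adj⁺′ {a} {b} {u} {v} a≤u v<a = trans (Graph.sym (K a b) u v) (K-adj⁺ v<a a≤u)

K-hasTDS≤2 : ∀ {a b} → 0 < a → 0 < b → ∃ λ S → IsTDS (K a b) S × ∣ S ∣ ≤ 2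
K-hasTDS≤2 {a} {b} 0<a 0<b = ⁅ x ⁆ ∪ ⁅ y ⁆ , dominates , size
  where
  0<n : 0 < a + b
  0<n = <-≤-trans 0<a (m≤m+n a b)
  a<n : a < a + b
  a<n = subst (_< a + b) (+-identityʳ a) (+-monoʳ-< a 0<b)
  x y : Fin (a + b)
  x = fromℕ< 0<n
  y = fromℕ< a<n
  dominates : IsTDS (K a b) (⁅ x ⁆ ∪ ⁅ y ⁆)
  dominates v with toℕ v <? a
  ... | yes v<a = y , q⊆p∪q ⁅ x ⁆ ⁅ y ⁆ (x∈⁅x⁆ y) , K-adj⁺′ (≤-reflexive (sym (toℕ-fromℕ< a<n))) v<a
  ... | no  v≮a = x , p⊆p∪q ⁅ y ⁆ (x∈⁅x⁆ x) , K-adj⁺ (subst (_< a) (sym (toℕ-fromℕ< 0<n)) 0<a) (≮⇒≥ v≮a)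
  size : ∣ ⁅ x ⁆ ∪ ⁅ y ⁆ ∣ ≤ 2
  size = ≤-trans (∣p∪q∣≤∣p∣+∣q∣ ⁅ x ⁆ ⁅ y ⁆) (≤-reflexive (cong₂ _+_ (∣⁅x⁆∣≡1 x) (∣⁅x⁆∣≡1 y)))

position : ℕ → ℕ → ℕ
position a j = if j <ᵇ a then j else j ∸ a

colour : ℕ → ℕ → ℕ → ℕ
colour a m j = position a j ⊓ m

-- Keeps exactly the edges {i, a+i} (i < m) and those of K_{a−m,b−m} on the
-- vertices m..a−1 and a+m..a+b−1.
splitK : (a b m : ℕ) → Graph (a + b)
splitK a b m = sameColourSubgraph (K a b) (colour a m ∘ toℕ)

module Colouring {a m : ℕ} where

  colour-A : ∀ {j} → j < a → colour a m j ≡ j ⊓ m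
  colour-A j<a rewrite <ᵇ-true j<a = refl

  colour-B : ∀ {j} → a ≤ j → colour a m j ≡ (j ∸ a) ⊓ m
  colour-B a≤j rewrite <ᵇ-false a≤j = refl

  colour-+ : ∀ i → colour a m (a + i) ≡ i ⊓ m
  colour-+ i = trans (colour-B (m≤m+n a i)) (cong (_⊓ m) (m+n∸m≡n a i))

  colour≤m : ∀ j → colour a m j ≤ m
  colour≤m j = m⊓n≤n (position a j) m

  -- At i = toℕ u, j = toℕ v this is, definitionally, the summand of
  -- deletedEdges (K a b) (splitK a b m).
  deletedPair : ℕ → ℕ → ℕ
  deletedPair i j = if (i <ᵇ j) ∧ across ∧ not (across ∧ (colour a m i ≡ᵇ colour a m j)) then 1 else 0
    where
    across : Bool
    across = (i <ᵇ a) xor (j <ᵇ a)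

  deletedPair≤1 : ∀ i j → deletedPair i j ≤ 1
  deletedPair≤1 i j = indicator≤1 _
    where
    indicator≤1 : ∀ x → (if x then 1 else 0) ≤ 1
    indicator≤1 true  = ≤-refl
    indicator≤1 false = z≤n

  deletedPair-backward : ∀ {i j} → j ≤ i → deletedPair i j ≡ 0
  deletedPair-backward j≤i rewrite <ᵇ-false j≤i = refl

  deletedPair-sameSide : ∀ {i j} → (i <ᵇ a) ≡ (j <ᵇ a) → deletedPair i j ≡ 0
  deletedPair-sameSide {i} {j} si≡sj rewrite si≡sj | xor-same (j <ᵇ a) | ∧-zeroʳ (i <ᵇ j) = refl

  deletedPair-sameColour : ∀ {i j} → colour a m i ≡ colour a m j → deletedPair i j ≡ 0
  deletedPair-sameColour {i} {j} ci≡cj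
    rewrite ≡⇒≡ᵇ≡true ci≡cj | ∧-identityʳ ((i <ᵇ a) xor (j <ᵇ a))
          | ∧-inverseʳ ((i <ᵇ a) xor (j <ᵇ a)) | ∧-zeroʳ (i <ᵇ j) = refl

m*[b∸1]+[a∸m]*m≡m*[a+b∸m∸1] : ∀ {a b m} → m ≤ a → 1 ≤ b → m * (b ∸ 1) + (a ∸ m) * m ≡ m * (a + b ∸ m ∸ 1)
m*[b∸1]+[a∸m]*m≡m*[a+b∸m∸1] {a} {b} {m} m≤a 1≤b = begin
  m * (b ∸ 1) + (a ∸ m) * m   ≡⟨ cong (m * (b ∸ 1) +_) (*-comm (a ∸ m) m) ⟩
  m * (b ∸ 1) + m * (a ∸ m)   ≡⟨ sym (*-distribˡ-+ m (b ∸ 1) (a ∸ m)) ⟩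
  m * ((b ∸ 1) + (a ∸ m))     ≡⟨ cong (m *_) (+-comm (b ∸ 1) (a ∸ m)) ⟩
  m * ((a ∸ m) + (b ∸ 1))     ≡⟨ cong (m *_) (sym (+-∸-assoc (a ∸ m) 1≤b)) ⟩
  m * ((a ∸ m) + b ∸ 1)       ≡⟨ cong (λ x → m * (x ∸ 1)) (sym (+-∸-comm b m≤a)) ⟩
  m * (a + b ∸ m ∸ 1)         ∎
  where open ≡-Reasoning

module SplitK {a b m : ℕ} (m<a : m < a) (m<b : m < b) where

  open SameColour {G = K a b} {c = colour a m ∘ toℕ}
  open Colouring {a} {m}

  noIsolated : NoIsolated (splitK a b m)
  noIsolated v with toℕ v <? a
  ... | yes v<a = fromℕ< a+c<a+b , sameColourSubgraph-adj⁺ (K-adj⁺′ a≤p v<a) same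
    where
    c : ℕ
    c = colour a m (toℕ v)
    a+c<a+b : a + c < a + b
    a+c<a+b = +-monoʳ-< a (≤-<-trans (colour≤m (toℕ v)) m<b)
    p≡a+c : toℕ (fromℕ< a+c<a+b) ≡ a + c
    p≡a+c = toℕ-fromℕ< a+c<a+b
    a≤p : a ≤ toℕ (fromℕ< a+c<a+b)
    a≤p = subst (a ≤_) (sym p≡a+c) (m≤m+n a c)
    same : colour a m (toℕ (fromℕ< a+c<a+b)) ≡ c
    same = trans (cong (colour a m) p≡a+c) (trans (colour-+ c) (m≤n⇒m⊓n≡m (colour≤m (toℕ v))))
  ... | no v≮a = fromℕ< c<a+b , sameColourSubgraph-adj⁺ (K-adj⁺ p<a (≮⇒≥ v≮a)) same
    where
    c : ℕ
    c = colour a m (toℕ v)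
    c<a : c < a
    c<a = ≤-<-trans (colour≤m (toℕ v)) m<a
    c<a+b : c < a + b
    c<a+b = <-≤-trans c<a (m≤m+n a b)
    p≡c : toℕ (fromℕ< c<a+b) ≡ c
    p≡c = toℕ-fromℕ< c<a+b
    p<a : toℕ (fromℕ< c<a+b) < a
    p<a = subst (_< a) (sym p≡c) c<a
    same : colour a m (toℕ (fromℕ< c<a+b)) ≡ c
    same = trans (cong (colour a m) p≡c) (trans (colour-A c<a) (m≤n⇒m⊓n≡m (colour≤m (toℕ v))))

  required-unique : ∀ {x y} → m ≤ x → x < a → m ≤ y → Unique (x ∷ a + y ∷ upTo m ++ applyUpTo (a +_) m)
  required-unique {x} {y} m≤x x<a m≤y =
    (x≢a+y ∷ All.++⁺ (All.applyUpTo⁺₁ _ m λ i<m → >⇒≢ (<-≤-trans i<m m≤x))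
                     (All.applyUpTo⁺₂ _ m λ i → <⇒≢ (<-≤-trans x<a (m≤m+n a i))))
    ∷ All.++⁺ (All.applyUpTo⁺₁ _ m λ i<m → >⇒≢ (<-≤-trans (<-trans i<m m<a) (m≤m+n a y)))
              (All.applyUpTo⁺₁ _ m λ i<m → >⇒≢ (+-monoʳ-< a (<-≤-trans i<m m≤y)))
    ∷ AllPairs.++⁺ (upTo⁺ m) (AllPairs.applyUpTo⁺₁ _ m λ i<j _ → <⇒≢ (+-monoʳ-< a i<j))
        (All.applyUpTo⁺₁ _ m λ i<m → All.applyUpTo⁺₂ _ m λ j → <⇒≢ (<-≤-trans (<-trans i<m m<a) (m≤m+n a j)))
    where
    x≢a+y : x ≢ a + y
    x≢a+y = <⇒≢ (<-≤-trans x<a (m≤m+n a y))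

  module _ {S : Subset (a + b)} (S-tds : IsTDS (splitK a b m) S) where

    neighbour-of-B : ∀ {i} → i < b → ∃ λ x → x ∈ℕ S × x < a × x ⊓ m ≡ i ⊓ m
    neighbour-of-B {i} i<b =
      let u , u∈S , Huv = S-tds (fromℕ< a+i<a+b)
          Kuv , same    = sameColourSubgraph-adj⁻ Huv
          u<a           = K-adj⇒< Kuv (subst (a ≤_) (sym v≡a+i) (m≤m+n a i))
      in toℕ u , (u , u∈S , refl) , u<a ,
         trans (sym (colour-A u<a)) (trans same (trans (cong (colour a m) v≡a+i) (colour-+ i)))
      where
      a+i<a+b : a + i < a + b
      a+i<a+b = +-monoʳ-< a i<b
      v≡a+i : toℕ (fromℕ< a+i<a+b) ≡ a + i
      v≡a+i = toℕ-fromℕ< a+i<a+b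

    neighbour-of-A : ∀ {i} → i < a → ∃ λ y → (a + y) ∈ℕ S × y ⊓ m ≡ i ⊓ m
    neighbour-of-A {i} i<a =
      let u , u∈S , Huv = S-tds (fromℕ< i<a+b)
          Kuv , same    = sameColourSubgraph-adj⁻ Huv
          a≤u           = K-adj⇒≥ Kuv (subst (_< a) (sym v≡i) i<a)
      in toℕ u ∸ a , (u , u∈S , sym (m+[n∸m]≡n a≤u)) ,
         trans (sym (colour-B a≤u)) (trans same (trans (cong (colour a m) v≡i) (colour-A i<a)))
      where
      i<a+b : i < a + b
      i<a+b = <-≤-trans i<a (m≤m+n a b)
      v≡i : toℕ (fromℕ< i<a+b) ≡ i
      v≡i = toℕ-fromℕ< i<a+b

    low∈S : ∀ {i} → i < m → i ∈ℕ S
    low∈S {i} i<m =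
      let x , x∈S , _ , x⊓m≡i⊓m = neighbour-of-B (<-trans i<m m<b)
      in subst (_∈ℕ S) (m⊓o≡n<o⇒m≡n (trans x⊓m≡i⊓m (m≤n⇒m⊓n≡m (<⇒≤ i<m))) i<m) x∈S

    high∈S : ∀ {i} → i < m → (a + i) ∈ℕ S
    high∈S {i} i<m =
      let y , a+y∈S , y⊓m≡i⊓m = neighbour-of-A (<-trans i<m m<a)
      in subst (λ j → (a + j) ∈ℕ S) (m⊓o≡n<o⇒m≡n (trans y⊓m≡i⊓m (m≤n⇒m⊓n≡m (<⇒≤ i<m))) i<m) a+y∈S

    ∣S∣≥2+2m : 2 + (m + m) ≤ ∣ S ∣
    ∣S∣≥2+2m =
      let x , x∈S , x<a , x⊓m≡m⊓m = neighbour-of-B m<b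
          y , a+y∈S , y⊓m≡m⊓m     = neighbour-of-A m<a
          m≤x = m⊓n≡n⇒n≤m (trans x⊓m≡m⊓m (⊓-idem m))
          m≤y = m⊓n≡n⇒n≤m (trans y⊓m≡m⊓m (⊓-idem m))
      in subst (_≤ ∣ S ∣) (cong (2 +_) length-required)
           (length≤∣S∣ S (required-unique m≤x x<a m≤y)
             (x∈S ∷ a+y∈S ∷ All.++⁺ (All.applyUpTo⁺₁ _ m low∈S) (All.applyUpTo⁺₁ _ m high∈S)))
      where
      length-required : length (upTo m ++ applyUpTo (a +_) m) ≡ m + m
      length-required = trans (length-++ (upTo m)) (cong₂ _+_ (length-upTo m) (length-applyUpTo (a +_) m))

  row : ℕ → ℕ
  row i = sumFrom (deletedPair i) 0 (a + b)

  row-A : ∀ {i} → i < a → row i ≤ sumFrom (deletedPair i) a b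
  row-A {i} i<a = ≤-trans (≤-reflexive (sumFrom-+ (deletedPair i) 0 a b)) (+-mono-≤ inside-A≤0 ≤-refl)
    where
    inside-A≤0 : sumFrom (deletedPair i) 0 a ≤ 0
    inside-A≤0 = ≤-trans (sumFrom-≤-* (deletedPair i) 0 a 0 λ j _ j<a →
      ≤-reflexive (deletedPair-sameSide (trans (<ᵇ-true i<a) (sym (<ᵇ-true j<a))))) (≤-reflexive (*-zeroʳ a))

  row-low : ∀ {i} → i < m → row i ≤ b ∸ 1
  row-low {i} i<m = ≤-trans (row-A i<a)
    (sumFrom-≤-pred (deletedPair≤1 i) a b (deletedPair-sameColour same) (m≤m+n a i) (+-monoʳ-< a (<-trans i<m m<b)))
    where
    i<a : i < a
    i<a = <-trans i<m m<a
    same : colour a m i ≡ colour a m (a + i)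
    same = trans (colour-A i<a) (sym (colour-+ i))

  row-mid : ∀ {i} → m ≤ i → i < a → row i ≤ m
  row-mid {i} m≤i i<a = ≤-trans (row-A i<a) (sumFrom-≤-support (deletedPair≤1 i) a b m λ j a+m≤j →
    deletedPair-sameColour (trans colour-i≡m (sym (colour≡m-B a+m≤j))))
    where
    colour-i≡m : colour a m i ≡ m
    colour-i≡m = trans (colour-A i<a) (m≥n⇒m⊓n≡n m≤i)
    colour≡m-B : ∀ {j} → a + m ≤ j → colour a m j ≡ m
    colour≡m-B {j} a+m≤j = trans (colour-B (≤-trans (m≤m+n a m) a+m≤j))
      (m≥n⇒m⊓n≡n (subst (_≤ j ∸ a) (m+n∸m≡n a m) (∸-monoˡ-≤ a a+m≤j)))

  row-B : ∀ {i} → a ≤ i → row i ≤ 0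
  row-B {i} a≤i = ≤-trans (sumFrom-≤-* (deletedPair i) 0 (a + b) 0 λ j _ _ → ≤-reflexive (vanishes j))
    (≤-reflexive (*-zeroʳ (a + b)))
    where
    vanishes : ∀ j → deletedPair i j ≡ 0
    vanishes j with j ≤? i
    ... | yes j≤i = deletedPair-backward j≤i
    ... | no  j≰i = deletedPair-sameSide (trans (<ᵇ-false a≤i) (sym (<ᵇ-false (≤-trans a≤i (<⇒≤ (≰⇒> j≰i))))))

  deletedEdges-splitK : deletedEdges (K a b) (splitK a b m) ≤ m * (a + b ∸ m ∸ 1)
  deletedEdges-splitK = begin
    deletedEdges (K a b) (splitK a b m)
      ≤⟨ sum-allFin≤sumFrom {a + b} {f = row} (λ u → sum-allFin≤sumFrom {a + b} λ v → ≤-refl) ⟩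
    sumFrom row 0 (a + b)                                     ≡⟨ sumFrom-+ row 0 a b ⟩
    sumFrom row 0 a + sumFrom row a b                         ≡⟨ cong (λ l → sumFrom row 0 l + sumFrom row a b) (sym a≡m+[a∸m]) ⟩
    sumFrom row 0 (m + (a ∸ m)) + sumFrom row a b             ≡⟨ cong (_+ sumFrom row a b) (sumFrom-+ row 0 m (a ∸ m)) ⟩
    sumFrom row 0 m + sumFrom row m (a ∸ m) + sumFrom row a b ≤⟨ +-mono-≤ (+-mono-≤ low mid) high ⟩
    m * (b ∸ 1) + (a ∸ m) * m + 0                             ≡⟨ +-identityʳ _ ⟩
    m * (b ∸ 1) + (a ∸ m) * m                                 ≡⟨ m*[b∸1]+[a∸m]*m≡m*[a+b∸m∸1] (<⇒≤ m<a) (≤-<-trans z≤n m<b) ⟩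
    m * (a + b ∸ m ∸ 1)                                       ∎
    where
    open ≤-Reasoning
    a≡m+[a∸m] : m + (a ∸ m) ≡ a
    a≡m+[a∸m] = m+[n∸m]≡n (<⇒≤ m<a)
    low : sumFrom row 0 m ≤ m * (b ∸ 1)
    low = sumFrom-≤-* row 0 m (b ∸ 1) λ i _ i<m → row-low i<m
    mid : sumFrom row m (a ∸ m) ≤ (a ∸ m) * m
    mid = sumFrom-≤-* row m (a ∸ m) m λ i m≤i i<a → row-mid m≤i (subst (i <_) a≡m+[a∸m] i<a)
    high : sumFrom row a b ≤ 0
    high = ≤-trans (sumFrom-≤-* row a b 0 λ i a≤i _ → row-B a≤i) (≤-reflexive (*-zeroʳ b))

theorem3p19 : (a b k : ℕ) → 1 ≤ k → ⌈ k /2⌉ + 1 ≤ a → a ≤ b →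
    (t : ℕ) → IsTotalDomNumber (K a b) t →
    ∃ λ (H : Graph (a + b)) →
      SpanningSubgraph H (K a b) × NoIsolated H × TotalDomAtLeast H (t + k) ×
      deletedEdges (K a b) H ≤ ⌈ k /2⌉ * (a + b ∸ ⌈ k /2⌉ ∸ 1)
theorem3p19 a b k _ m+1≤a a≤b t (_ , γₜ-minimal) =
  splitK a b m , SameColour.sameColourSubgraph-spanning {G = K a b} {c = colour a m ∘ toℕ} ,
  noIsolated , γₜ≥t+k , deletedEdges-splitK
  where
  m : ℕ
  m = ⌈ k /2⌉
  m<a : m < a
  m<a = subst (_≤ a) (+-comm m 1) m+1≤a
  m<b : m < b
  m<b = <-≤-trans m<a a≤b
  open SplitK m<a m<b
  t≤2 : t ≤ 2
  t≤2 = let S , S-tds , ∣S∣≤2 = K-hasTDS≤2 (≤-<-trans z≤n m<a) (≤-<-trans z≤n m<b)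
        in ≤-trans (γₜ-minimal S S-tds) ∣S∣≤2
  γₜ≥t+k : TotalDomAtLeast (splitK a b m) (t + k)
  γₜ≥t+k S S-tds = ≤-trans (+-mono-≤ t≤2 (k≤⌈k/2⌉+⌈k/2⌉ k)) (∣S∣≥2+2m S-tds)
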